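{- Let $m\in\mathbb Z$. Then $25m$ is represented by $x^2+2y^2+5z^2$ if and only if $m$ is represented by $x^2+2y^2+5z^2$.
   Context: An integer $n$ is represented by a form $Q(x,y,z)$ if there exist integers $x,y,z$ with $Q(x,y,z)=n$. -}

module Defs where

open import Data.Integer using (ℤ; _+_; _*_; +_)
open import Data.Product using (∃-syntax)
open import Relation.Binary.PropositionalEquality using (_≡_)

Q : ℤ → ℤ → ℤ → ℤ
Q x y z = x * x + (+ 2) * (y * y) + (+ 5) * (z * z)

RepresentedByQ : ℤ → Set
RepresentedByQ n = ∃[ x ] ∃[ y ] ∃[ z ] Q x y z ≡ n

{-# OPTIONS --safe #-}
-- The squares mod 5 are 0 and ±1, so -2 is not a square mod 5 and 5 ∣ x² + 2y² forces 5 ∣ x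
-- and 5 ∣ y. If Q(x,y,z) = 25m, then 25 ∣ x² + 2y², hence 25 ∣ 5z² and 5 ∣ z; as Q is a
-- quadratic form, (x/5, y/5, z/5) then represents m. Conversely, scale a representation of m by 5.
module Submission where

open import Defs
open import Data.Integer using (ℤ; _*_; +_; _+_; _-_; ∣_∣; _/_; _%_; NonZero)
open import Data.Integer.DivMod using (a≡a%n+[a/n]*n; n%d<d)
open import Data.Integer.Divisibility.Signed
  using (_∣_; _∣?_; divides; ∣-refl; ∣-trans; ∣ᵤ⇒∣; ∣⇒∣ᵤ; ∣m⇒∣m*n; ∣n⇒∣m*n;
         ∣m∣n⇒∣m+n; ∣m∣n⇒∣m-n; ∣m+n∣m⇒∣n; ∣m+n∣n⇒∣m; *-monoʳ-∣; *-monoˡ-∣; *-cancelˡ-∣)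
open import Data.Integer.Properties using (abs-*; +-identityʳ; *-cancelˡ-≡)
open import Data.Integer.Tactic.RingSolver using (solve-∀)
open import Data.Nat as ℕ using (_<_)
import Data.Nat.Divisibility as ℕ
open import Data.Nat.Primality using (Prime; prime?; euclidsLemma)
open import Data.Nat.Properties using (allUpTo?)
open import Data.Product using (_,_; _×_; proj₁; proj₂; map)
open import Data.Sum using ([_,_]′)
open import Function using (id)
open import Function.Bundles using (_⇔_; mk⇔)
open import Relation.Nullary.Decidable using (Dec; toWitness; _→-dec_; _×-dec_)
open import Relation.Binary.PropositionalEquality using (_≡_; refl; sym; trans; cong; subst; module ≡-Reasoning)

*-pres-∣ : ∀ {k l a b} → k ∣ a → l ∣ b → k * l ∣ a * b
*-pres-∣ {k} {b = b} k∣a l∣b = ∣-trans (*-monoʳ-∣ k l∣b) (*-monoˡ-∣ b k∣a)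

n∣x-x%n : ∀ x n .{{_ : NonZero n}} → n ∣ x - + (x % n)
n∣x-x%n x n = divides (x / n) (begin
  x - + (x % n)                         ≡⟨ cong (_- + (x % n)) (a≡a%n+[a/n]*n x n) ⟩
  (+ (x % n) + (x / n) * n) - + (x % n) ≡⟨ sum-sub-left (+ (x % n)) ((x / n) * n) ⟩
  (x / n) * n                           ∎)
  where
  open ≡-Reasoning
  sum-sub-left : ∀ a b → (a + b) - a ≡ b
  sum-sub-left = solve-∀

x%n≡0⇒n∣x : ∀ x n .{{_ : NonZero n}} → x % n ≡ 0 → n ∣ x
x%n≡0⇒n∣x x n x%n≡0 = subst (n ∣_) (+-identityʳ x) (subst (λ r → n ∣ x - + r) x%n≡0 (n∣x-x%n x n))

∣-sub-squares : ∀ {k} a b → k ∣ a - b → k ∣ a * a - b * b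
∣-sub-squares {k} a b k∣a-b = subst (k ∣_) (difference-of-squares a b) (∣m⇒∣m*n (a + b) k∣a-b)
  where
  difference-of-squares : ∀ a b → (a - b) * (a + b) ≡ a * a - b * b
  difference-of-squares = solve-∀

prime∣x*x⇒prime∣x : ∀ {p x} → Prime p → + p ∣ x * x → + p ∣ x
prime∣x*x⇒prime∣x {p} {x} p-prime p∣x*x =
  ∣ᵤ⇒∣ ([ id , id ]′ (euclidsLemma ∣ x ∣ ∣ x ∣ p-prime (subst (p ℕ.∣_) (abs-* x x) (∣⇒∣ᵤ p∣x*x))))

5-prime : Prime 5
5-prime = toWitness {a? = prime? 5} _

5∣r²+2s²⇒r≡0×s≡0 : ∀ {r s} → r < 5 → s < 5 → + 5 ∣ + r * + r + + 2 * (+ s * + s) → r ≡ 0 × s ≡ 0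
5∣r²+2s²⇒r≡0×s≡0 r<5 s<5 = toWitness {a? = allUpTo? (λ r → allUpTo? (check r) 5) 5} _ r<5 s<5
  where
  check : ∀ r s → Dec (+ 5 ∣ + r * + r + + 2 * (+ s * + s) → r ≡ 0 × s ≡ 0)
  check r s = (+ 5 ∣? + r * + r + + 2 * (+ s * + s)) →-dec ((r ℕ.≟ 0) ×-dec (s ℕ.≟ 0))

5∣x²+2y²⇒5∣x×5∣y : ∀ x y → + 5 ∣ x * x + + 2 * (y * y) → (+ 5 ∣ x) × (+ 5 ∣ y)
5∣x²+2y²⇒5∣x×5∣y x y 5∣x²+2y² =
  map (x%n≡0⇒n∣x x (+ 5)) (x%n≡0⇒n∣x y (+ 5))
      (5∣r²+2s²⇒r≡0×s≡0 (n%d<d x (+ 5)) (n%d<d y (+ 5)) 5∣r²+2s²)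
  where
  r s : ℤ
  r = + (x % + 5)
  s = + (y % + 5)

  5∣x²+2y²-[r²+2s²] : + 5 ∣ (x * x + + 2 * (y * y)) - (r * r + + 2 * (s * s))
  5∣x²+2y²-[r²+2s²] = subst (+ 5 ∣_) (regroup x r y s)
    (∣m∣n⇒∣m+n (∣-sub-squares x r (n∣x-x%n x (+ 5)))
               (∣n⇒∣m*n (+ 2) (∣-sub-squares y s (n∣x-x%n y (+ 5)))))
    where
    regroup : ∀ a b c d → (a * a - b * b) + + 2 * (c * c - d * d) ≡ (a * a + + 2 * (c * c)) - (b * b + + 2 * (d * d))
    regroup = solve-∀

  5∣r²+2s² : + 5 ∣ r * r + + 2 * (s * s)
  5∣r²+2s² = subst (+ 5 ∣_) (sub-sub (x * x + + 2 * (y * y)) (r * r + + 2 * (s * s)))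
    (∣m∣n⇒∣m-n 5∣x²+2y² 5∣x²+2y²-[r²+2s²])
    where
    sub-sub : ∀ a b → a - (a - b) ≡ b
    sub-sub = solve-∀

Q-homogeneous : ∀ k x y z → Q (x * k) (y * k) (z * k) ≡ (k * k) * Q x y z
Q-homogeneous k x y z = homogeneous k x y z
  where
  -- stated with Q unfolded, since the ring solver does not see through definitions
  homogeneous : ∀ k x y z →
    (x * k) * (x * k) + + 2 * ((y * k) * (y * k)) + + 5 * ((z * k) * (z * k))
      ≡ (k * k) * (x * x + + 2 * (y * y) + + 5 * (z * z))
  homogeneous = solve-∀

Q≡25m⇒5∣x×5∣y×5∣z : ∀ x y z {m} → Q x y z ≡ + 25 * m → (+ 5 ∣ x) × (+ 5 ∣ y) × (+ 5 ∣ z)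
Q≡25m⇒5∣x×5∣y×5∣z x y z {m} Q≡25m = 5∣x , 5∣y , 5∣z
  where
  5∣Q : + 5 ∣ Q x y z
  5∣Q = subst (+ 5 ∣_) (sym Q≡25m) (∣m⇒∣m*n m (divides (+ 5) refl))

  5∣x×5∣y : (+ 5 ∣ x) × (+ 5 ∣ y)
  5∣x×5∣y = 5∣x²+2y²⇒5∣x×5∣y x y (∣m+n∣n⇒∣m 5∣Q (∣m⇒∣m*n (z * z) ∣-refl))

  5∣x : + 5 ∣ x
  5∣x = proj₁ 5∣x×5∣y

  5∣y : + 5 ∣ y
  5∣y = proj₂ 5∣x×5∣y

  25∣x²+2y² : + 25 ∣ x * x + + 2 * (y * y)
  25∣x²+2y² = ∣m∣n⇒∣m+n (*-pres-∣ 5∣x 5∣x) (∣n⇒∣m*n (+ 2) (*-pres-∣ 5∣y 5∣y))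

  25∣Q : + 25 ∣ Q x y z
  25∣Q = subst (+ 25 ∣_) (sym Q≡25m) (∣m⇒∣m*n m ∣-refl)

  5∣z : + 5 ∣ z
  5∣z = prime∣x*x⇒prime∣x 5-prime (*-cancelˡ-∣ (+ 5) (∣m+n∣m⇒∣n 25∣Q 25∣x²+2y²))

Q≡m⇒Q[5x,5y,5z]≡25m : ∀ x y z {m} → Q x y z ≡ m → Q (x * + 5) (y * + 5) (z * + 5) ≡ + 25 * m
Q≡m⇒Q[5x,5y,5z]≡25m x y z Q≡m = trans (Q-homogeneous (+ 5) x y z) (cong (+ 25 *_) Q≡m)

Q≡25m⇒represented[m] : ∀ x y z {m} → Q x y z ≡ + 25 * m → RepresentedByQ m
Q≡25m⇒represented[m] x y z Q≡25m = divide-by-5 x y z (Q≡25m⇒5∣x×5∣y×5∣z x y z Q≡25m) Q≡25m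
  where
  divide-by-5 : ∀ x y z {m} → (+ 5 ∣ x) × (+ 5 ∣ y) × (+ 5 ∣ z) → Q x y z ≡ + 25 * m → RepresentedByQ m
  divide-by-5 _ _ _ {m} (divides x′ refl , divides y′ refl , divides z′ refl) Q≡25m =
    x′ , y′ , z′ ,
    *-cancelˡ-≡ (+ 25) (Q x′ y′ z′) m (trans (sym (Q-homogeneous (+ 5) x′ y′ z′)) Q≡25m)

mainTheorem15 : (m : ℤ) → RepresentedByQ (+ 25 * m) ⇔ RepresentedByQ m
mainTheorem15 m = mk⇔
  (λ (x , y , z , Q≡25m) → Q≡25m⇒represented[m] x y z Q≡25m)
  (λ (x , y , z , Q≡m) → x * + 5 , y * + 5 , z * + 5 , Q≡m⇒Q[5x,5y,5z]≡25m x y z Q≡m)
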